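{- Let $\mathbf{Q}$ be a non-flat QB-algebra, $\theta$ a congruence on the subalgebra $\mathscr{R}(\mathbf{Q})$, $x\in\mathscr{IR}(Q)$ and $y\in cl(x\vee x)\setminus\mathscr{R}(Q)$. Then $\theta_{x,y}=\theta\cup\Delta\cup\{\langle x,y\rangle,\langle y,x\rangle,\langle x^{*},y^{*}\rangle,\langle y^{*},x^{*}\rangle\}$ is a congruence on $\mathbf{Q}$, where $\Delta=\{\langle a,a\rangle: a\in Q\}$.
   Context: A quasi-lattice is an algebra $\langle L;\vee,\wedge\rangle$ such that for all $x,y,z$: $\vee,\wedge$ are commutative and associative; $x\vee(x\wedge y)=x\vee x$ and $x\wedge(x\vee y)=x\wedge x$; $x\vee(y\vee y)=x\vee y$ and $x\wedge(y\wedge y)=x\wedge y$; $x\vee x=x\wedge x$; distributive if both distributive laws hold. A QB-algebra is an algebra $\langle Q;\vee,\wedge,{}^{*},0,1\rangle$ of type $\langle 2,2,1,0,0\rangle$ such that $\langle Q;\vee,\wedge\rangle$ is a distributive quasi-lattice and for all $x$: $x\vee 1=1$, $x\wedge 0=0$, $x\vee x^{*}=1$, $x\wedge x^{*}=0$, $(x\wedge x)^{*}=x^{*}\vee x^{*}$, $x^{**}=x$. A QB-algebra is flat if $1=0$. An element $x$ is regular if $x\vee x=x$; $\mathscr{R}(Q)$ is the set of regular elements and $\mathscr{IR}(Q)=Q\setminus\mathscr{R}(Q)$. $\mathscr{R}(Q)$ is closed under all operations and $\mathscr{R}(\mathbf{Q})$ denotes the resulting subalgebra (a Boolean algebra). For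 regular $r$, $cl(r)=\{z\in Q: z\vee z=r\vee r\}$. -}

module Defs where

open import Level using (Level; _⊔_; suc)
open import Data.Product using (Σ; _×_; _,_; ∃)
open import Data.Sum using (_⊎_)
open import Relation.Nullary using (¬_)
open import Relation.Binary.PropositionalEquality using (_≡_)
open import Relation.Binary.Core using (Rel)
open import Relation.Binary.Structures using (IsEquivalence)

record QBAlgebra (a : Level) : Set (suc a) where
  infixr 6 _∨_
  infixr 7 _∧_
  field
    Carrier : Set a
    _∨_ _∧_ : Carrier → Carrier → Carrier
    _* : Carrier → Carrier
    𝟘 𝟙 : Carrier
    ∨-comm : ∀ x y → x ∨ y ≡ y ∨ x
    ∧-comm : ∀ x y → x ∧ y ≡ y ∧ x
    ∨-assoc : ∀ x y z → (x ∨ y) ∨ z ≡ x ∨ (y ∨ z)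
    ∧-assoc : ∀ x y z → (x ∧ y) ∧ z ≡ x ∧ (y ∧ z)
    ∨-absorb : ∀ x y → x ∨ (x ∧ y) ≡ x ∨ x
    ∧-absorb : ∀ x y → x ∧ (x ∨ y) ≡ x ∧ x
    ∨-idem-r : ∀ x y → x ∨ (y ∨ y) ≡ x ∨ y
    ∧-idem-r : ∀ x y → x ∧ (y ∧ y) ≡ x ∧ y
    ∨∧-same : ∀ x → x ∨ x ≡ x ∧ x
    ∧-distrib-∨ : ∀ x y z → x ∧ (y ∨ z) ≡ (x ∧ y) ∨ (x ∧ z)
    ∨-distrib-∧ : ∀ x y z → x ∨ (y ∧ z) ≡ (x ∨ y) ∧ (x ∨ z)
    ∨-𝟙 : ∀ x → x ∨ 𝟙 ≡ 𝟙
    ∧-𝟘 : ∀ x → x ∧ 𝟘 ≡ 𝟘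
    ∨-compl : ∀ x → x ∨ (x *) ≡ 𝟙
    ∧-compl : ∀ x → x ∧ (x *) ≡ 𝟘
    compl-sq : ∀ x → (x ∧ x) * ≡ (x *) ∨ (x *)
    compl-invol : ∀ x → (x *) * ≡ x

  Flat : Set a
  Flat = 𝟙 ≡ 𝟘

  Regular : Carrier → Set a
  Regular x = x ∨ x ≡ x

  R : Set a
  R = Σ Carrier Regular

  cl : Carrier → Carrier → Set a
  cl r z = z ∨ z ≡ r ∨ r

module _ {a : Level} (Q : QBAlgebra a) where
  open QBAlgebra Q

  -- A congruence on the algebra Q (operations ∨, ∧, *; constants are trivially compatible)
  record IsCongruence {ℓ : Level} (θ : Rel Carrier ℓ) : Set (a ⊔ ℓ) where
    field
      isEquivalence : IsEquivalence θ
      ∨-cong : ∀ {x x′ y y′} → θ x x′ → θ y y′ → θ (x ∨ y) (x′ ∨ y′)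
      ∧-cong : ∀ {x x′ y y′} → θ x x′ → θ y y′ → θ (x ∧ y) (x′ ∧ y′)
      *-cong : ∀ {x x′} → θ x x′ → θ (x *) (x′ *)

  record IsCongruenceR {ℓ : Level} (θ : Rel R ℓ) : Set (a ⊔ ℓ) where
    field
      isEquivalence : IsEquivalence θ
      ∨-cong : ∀ {x x′ y y′ : R} → θ x x′ → θ y y′ →
        ∀ (r : Regular (Σ.proj₁ x ∨ Σ.proj₁ y)) (r′ : Regular (Σ.proj₁ x′ ∨ Σ.proj₁ y′)) →
        θ (Σ.proj₁ x ∨ Σ.proj₁ y , r) (Σ.proj₁ x′ ∨ Σ.proj₁ y′ , r′)
      ∧-cong : ∀ {x x′ y y′ : R} → θ x x′ → θ y y′ →
        ∀ (r : Regular (Σ.proj₁ x ∧ Σ.proj₁ y)) (r′ : Regular (Σ.proj₁ x′ ∧ Σ.proj₁ y′)) →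
        θ (Σ.proj₁ x ∧ Σ.proj₁ y , r) (Σ.proj₁ x′ ∧ Σ.proj₁ y′ , r′)
      *-cong : ∀ {x x′ : R} → θ x x′ →
        ∀ (r : Regular (Σ.proj₁ x *)) (r′ : Regular (Σ.proj₁ x′ *)) →
        θ (Σ.proj₁ x * , r) (Σ.proj₁ x′ * , r′)

  liftR : {ℓ : Level} → Rel R ℓ → Rel Carrier (a ⊔ ℓ)
  liftR θ u v = Σ (Regular u) λ ru → Σ (Regular v) λ rv → θ (u , ru) (v , rv)

  θxy : {ℓ : Level} → Rel R ℓ → Carrier → Carrier → Rel Carrier (a ⊔ ℓ)
  θxy θ x y u v =
    liftR θ u v
    ⊎ u ≡ v
    ⊎ (u ≡ x × v ≡ y)
    ⊎ (u ≡ y × v ≡ x)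
    ⊎ (u ≡ x * × v ≡ y *)
    ⊎ (u ≡ y * × v ≡ x *)

-- Squares u ∨ u (= u ∧ u) are regular, and
-- u ∨ w = (u ∨ u) ∨ (w ∨ w), u ∧ w = (u ∧ u) ∧ (w ∧ w).  Elements related by θ_{x,y}
-- have θ-related squares (x and y have the same square, hence so do x* and y*), so
-- compatibility of ∨ and ∧ reduces to that of θ.  Transitivity is the only delicate
-- point: the pairs beyond θ ∪ Δ live inside the blocks {x, y} and {x*, y*} of
-- irregular elements, and if these blocks meet they coincide, since u ≠ u* in a
-- non-flat algebra.
module Submission where

open import Defs
open import Level using (Level; _⊔_)
open import Relation.Nullary using (¬_)
open import Relation.Binary.Core using (Rel)
open import Relation.Binary.Structures using (IsEquivalence)
open import Relation.Binary.PropositionalEquality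
  using (_≡_; refl; sym; trans; cong; cong₂; subst; subst₂; module ≡-Reasoning)
open import Data.Product using (_×_; _,_; proj₁; proj₂)
open import Data.Sum using (_⊎_; inj₁; inj₂)
open import Data.Empty using (⊥-elim)
open import Algebra.Bundles using (CommutativeSemigroup)
import Algebra.Properties.CommutativeSemigroup as CommutativeSemigroupProperties

pattern θ-rel ru rv h = inj₁ (ru , rv , h)
pattern Δ-rel = inj₂ (inj₁ refl)
pattern special s = inj₂ (inj₂ s)

pattern x↦y = inj₁ (refl , refl)
pattern y↦x = inj₂ (inj₁ (refl , refl))
pattern x*↦y* = inj₂ (inj₂ (inj₁ (refl , refl)))
pattern y*↦x* = inj₂ (inj₂ (inj₂ (refl , refl)))

module SquareLaws {a : Level} {A : Set a} (_·_ : A → A → A)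
  (comm : ∀ u w → u · w ≡ w · u)
  (assoc : ∀ u w z → (u · w) · z ≡ u · (w · z))
  (idem-r : ∀ u w → u · (w · w) ≡ u · w) where
  open ≡-Reasoning

  private
    commutativeSemigroup : CommutativeSemigroup a a
    commutativeSemigroup = record
      { _≈_ = _≡_
      ; _∙_ = _·_
      ; isCommutativeSemigroup = record
        { isSemigroup = record
          { isMagma = record
            { isEquivalence = record { refl = refl ; sym = sym ; trans = trans }
            ; ∙-cong = cong₂ _·_ }
          ; assoc = assoc }
        ; comm = comm } }
    open CommutativeSemigroupProperties commutativeSemigroup using (interchange)

  squares : ∀ u w → (u · u) · (w · w) ≡ u · w
  squares u w = begin
    (u · u) · (w · w) ≡⟨ idem-r (u · u) w ⟩
    (u · u) · w       ≡⟨ comm (u · u) w ⟩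
    w · (u · u)       ≡⟨ idem-r w u ⟩
    w · u             ≡⟨ comm w u ⟩
    u · w             ∎

  product-square : ∀ u w → (u · w) · (u · w) ≡ u · w
  product-square u w = trans (interchange u w u w) (squares u w)

module QBProperties {a : Level} (Q : QBAlgebra a) where
  open QBAlgebra Q
  open ≡-Reasoning

  open SquareLaws _∨_ ∨-comm ∨-assoc ∨-idem-r public
    renaming (squares to ∨-squares; product-square to ∨-product-square)
  open SquareLaws _∧_ ∧-comm ∧-assoc ∧-idem-r public
    renaming (squares to ∧-squares; product-square to ∧-product-square)

  ∨-regular : ∀ u w → Regular (u ∨ w)
  ∨-regular = ∨-product-square

  ∧-regular : ∀ u w → Regular (u ∧ w)
  ∧-regular u w = trans (∨∧-same (u ∧ w)) (∧-product-square u w)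

  square-* : ∀ u → u * ∨ u * ≡ (u ∨ u) *
  square-* u = trans (sym (compl-sq u)) (cong _* (sym (∨∧-same u)))

  *-regular : ∀ {u} → Regular u → Regular (u *)
  *-regular {u} ru = trans (square-* u) (cong _* ru)

  *-irregular : ∀ {u} → ¬ Regular u → ¬ Regular (u *)
  *-irregular {u} nu ru* = nu (subst Regular (compl-invol u) (*-regular ru*))

  equal-squares-* : ∀ {u v} → u ∨ u ≡ v ∨ v → u * ∨ u * ≡ v * ∨ v *
  equal-squares-* {u} {v} e = begin
    u * ∨ u *  ≡⟨ square-* u ⟩
    (u ∨ u) *  ≡⟨ cong _* e ⟩
    (v ∨ v) *  ≡⟨ square-* v ⟨
    v * ∨ v *  ∎

  ≡*⇒flat : ∀ {u} → u ≡ u * → Flat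
  ≡*⇒flat {u} e = begin
    𝟙        ≡⟨ ∨-compl u ⟨
    u ∨ u *  ≡⟨ cong (u ∨_) e ⟨
    u ∨ u    ≡⟨ ∨∧-same u ⟩
    u ∧ u    ≡⟨ cong (u ∧_) e ⟩
    u ∧ u *  ≡⟨ ∧-compl u ⟩
    𝟘        ∎

  infix 4 _∈⟅_,_⟆
  _∈⟅_,_⟆ : Carrier → Carrier → Carrier → Set a
  z ∈⟅ p , q ⟆ = z ≡ p ⊎ z ≡ q

  ∈⟅⟆-** : ∀ {z p q} → z ∈⟅ p , q ⟆ → z ∈⟅ p * * , q * * ⟆
  ∈⟅⟆-** {z} {p} {q} = subst₂ (λ p′ q′ → z ∈⟅ p′ , q′ ⟆) (sym (compl-invol p)) (sym (compl-invol q))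

  ∈⟅⟆-irregular : ∀ {z p q} → ¬ Regular p → ¬ Regular q → z ∈⟅ p , q ⟆ → ¬ Regular z
  ∈⟅⟆-irregular np nq (inj₁ refl) = np
  ∈⟅⟆-irregular np nq (inj₂ refl) = nq

  pair-overlap : ¬ Flat → ∀ {p q b d} →
    b ∈⟅ p , q ⟆ → b ∈⟅ p * , q * ⟆ → d ∈⟅ p * , q * ⟆ → d ∈⟅ p , q ⟆
  pair-overlap nf (inj₁ refl) (inj₁ e) _ = ⊥-elim (nf (≡*⇒flat e))
  pair-overlap nf {q = q} (inj₁ refl) (inj₂ e) (inj₁ refl) = inj₂ (trans (cong _* e) (compl-invol q))
  pair-overlap nf (inj₁ refl) (inj₂ e) (inj₂ refl) = inj₁ (sym e)
  pair-overlap nf (inj₂ refl) (inj₁ e) (inj₁ refl) = inj₂ (sym e)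
  pair-overlap nf {p = p} (inj₂ refl) (inj₁ e) (inj₂ refl) = inj₁ (trans (cong _* e) (compl-invol p))
  pair-overlap nf (inj₂ refl) (inj₂ e) _ = ⊥-elim (nf (≡*⇒flat e))

module CongruenceOnRegular {a ℓ : Level} (Q : QBAlgebra a)
  {θ : Rel (QBAlgebra.R Q) ℓ} (C : IsCongruenceR Q θ) where
  open QBAlgebra Q
  private module θ = IsCongruenceR C
  private module θ-equiv = IsEquivalence θ.isEquivalence

  -- Regularity proofs need not be unique, so θ is read on Carrier by demanding all choices.
  Related : Carrier → Carrier → Set (a ⊔ ℓ)
  Related u v = ∀ p q → θ (u , p) (v , q)

  -- ∨-cong leaves the witnesses of the result free, and v ∨ v is v itself.
  related-refl : ∀ {v} → Regular v → Related v v
  related-refl {v} rv = subst (λ z → Related z z) rv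
    (θ.∨-cong {v , rv} {v , rv} {v , rv} {v , rv} θ-equiv.refl θ-equiv.refl)

  θ⇒related : ∀ {u v p q} → θ (u , p) (v , q) → Related u v
  θ⇒related {p = p} {q} h p′ q′ =
    θ-equiv.trans (related-refl p p′ p) (θ-equiv.trans h (related-refl q q q′))

module ThetaXY {a ℓ : Level} (Q : QBAlgebra a) (nonflat : ¬ QBAlgebra.Flat Q)
  (θ : Rel (QBAlgebra.R Q) ℓ) (C : IsCongruenceR Q θ)
  (x y : QBAlgebra.Carrier Q) (x-irregular : ¬ QBAlgebra.Regular Q x)
  (y∈cl : QBAlgebra.cl Q (QBAlgebra._∨_ Q x x) y) (y-irregular : ¬ QBAlgebra.Regular Q y) where
  open QBAlgebra Q
  open QBProperties Q
  open CongruenceOnRegular Q C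
  private module θ = IsCongruenceR C
  private module θ-equiv = IsEquivalence θ.isEquivalence

  Θ : Rel Carrier (a ⊔ ℓ)
  Θ = θxy Q θ x y

  Special : Rel Carrier a
  Special u v = (u ≡ x × v ≡ y) ⊎ (u ≡ y × v ≡ x) ⊎ (u ≡ x * × v ≡ y *) ⊎ (u ≡ y * × v ≡ x *)

  SameBlock : Rel Carrier a
  SameBlock u v = (u ∈⟅ x , y ⟆ × v ∈⟅ x , y ⟆) ⊎ (u ∈⟅ x * , y * ⟆ × v ∈⟅ x * , y * ⟆)

  special⇒sameBlock : ∀ {u v} → Special u v → SameBlock u v
  special⇒sameBlock x↦y = inj₁ (inj₁ refl , inj₂ refl)
  special⇒sameBlock y↦x = inj₁ (inj₂ refl , inj₁ refl)
  special⇒sameBlock x*↦y* = inj₂ (inj₁ refl , inj₂ refl)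
  special⇒sameBlock y*↦x* = inj₂ (inj₂ refl , inj₁ refl)

  sameBlock-trans : ∀ {u v w} → SameBlock u v → SameBlock v w → SameBlock u w
  sameBlock-trans (inj₁ (u∈ , _)) (inj₁ (_ , w∈)) = inj₁ (u∈ , w∈)
  sameBlock-trans (inj₁ (u∈ , v∈)) (inj₂ (v∈* , w∈*)) = inj₁ (u∈ , pair-overlap nonflat v∈ v∈* w∈*)
  sameBlock-trans (inj₂ (u∈* , v∈*)) (inj₁ (v∈ , w∈)) =
    inj₂ (u∈* , pair-overlap nonflat v∈* (∈⟅⟆-** v∈) (∈⟅⟆-** w∈))
  sameBlock-trans (inj₂ (u∈* , _)) (inj₂ (_ , w∈*)) = inj₂ (u∈* , w∈*)

  sameBlock⇒θxy : ∀ {u v} → SameBlock u v → Θ u v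
  sameBlock⇒θxy (inj₁ (inj₁ refl , inj₁ refl)) = Δ-rel
  sameBlock⇒θxy (inj₁ (inj₁ refl , inj₂ refl)) = special x↦y
  sameBlock⇒θxy (inj₁ (inj₂ refl , inj₁ refl)) = special y↦x
  sameBlock⇒θxy (inj₁ (inj₂ refl , inj₂ refl)) = Δ-rel
  sameBlock⇒θxy (inj₂ (inj₁ refl , inj₁ refl)) = Δ-rel
  sameBlock⇒θxy (inj₂ (inj₁ refl , inj₂ refl)) = special x*↦y*
  sameBlock⇒θxy (inj₂ (inj₂ refl , inj₁ refl)) = special y*↦x*
  sameBlock⇒θxy (inj₂ (inj₂ refl , inj₂ refl)) = Δ-rel

  sameBlock-irregular : ∀ {u v} → SameBlock u v → ¬ Regular u × ¬ Regular v
  sameBlock-irregular (inj₁ (u∈ , v∈)) =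
    ∈⟅⟆-irregular x-irregular y-irregular u∈ , ∈⟅⟆-irregular x-irregular y-irregular v∈
  sameBlock-irregular (inj₂ (u∈ , v∈)) =
    ∈⟅⟆-irregular x*-irregular y*-irregular u∈ , ∈⟅⟆-irregular x*-irregular y*-irregular v∈
    where
    x*-irregular : ¬ Regular (x *)
    x*-irregular = *-irregular x-irregular
    y*-irregular : ¬ Regular (y *)
    y*-irregular = *-irregular y-irregular

  y²≡x² : y ∨ y ≡ x ∨ x
  y²≡x² = trans y∈cl (∨-regular x x)

  special-squares : ∀ {u v} → Special u v → u ∨ u ≡ v ∨ v
  special-squares x↦y = sym y²≡x²
  special-squares y↦x = y²≡x²
  special-squares x*↦y* = equal-squares-* (special-squares x↦y)
  special-squares y*↦x* = equal-squares-* (special-squares y↦x)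

  square-related : ∀ {u v} → Θ u v → Related (u ∨ u) (v ∨ v)
  square-related (θ-rel _ _ h) = θ.∨-cong h h
  square-related {u} Δ-rel = related-refl (∨-regular u u)
  square-related {u} (special s) =
    subst (Related (u ∨ u)) (special-squares s) (related-refl (∨-regular u u))

  θxy-sym : ∀ {u v} → Θ u v → Θ v u
  θxy-sym (θ-rel ru rv h) = θ-rel rv ru (θ-equiv.sym h)
  θxy-sym Δ-rel = Δ-rel
  θxy-sym (special x↦y) = special y↦x
  θxy-sym (special y↦x) = special x↦y
  θxy-sym (special x*↦y*) = special y*↦x*
  θxy-sym (special y*↦x*) = special x*↦y*

  θxy-trans : ∀ {u v w} → Θ u v → Θ v w → Θ u w
  θxy-trans Δ-rel h = h
  θxy-trans h Δ-rel = h
  θxy-trans (θ-rel ru rv h) (θ-rel _ rw h′) = θ-rel ru rw (θ-equiv.trans h (θ⇒related h′ rv rw))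
  θxy-trans (θ-rel _ rv _) (special s) = ⊥-elim (proj₁ (sameBlock-irregular (special⇒sameBlock s)) rv)
  θxy-trans (special s) (θ-rel rv _ _) = ⊥-elim (proj₂ (sameBlock-irregular (special⇒sameBlock s)) rv)
  θxy-trans (special s) (special s′) =
    sameBlock⇒θxy (sameBlock-trans (special⇒sameBlock s) (special⇒sameBlock s′))

  θxy-∨ : ∀ {u u′ w w′} → Θ u u′ → Θ w w′ → Θ (u ∨ w) (u′ ∨ w′)
  θxy-∨ {u} {u′} {w} {w′} h₁ h₂ = θ-rel (∨-regular u w) (∨-regular u′ w′)
    (subst₂ Related (∨-squares u w) (∨-squares u′ w′) squares-related _ _)
    where
    squares-related : Related ((u ∨ u) ∨ (w ∨ w)) ((u′ ∨ u′) ∨ (w′ ∨ w′))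
    squares-related = θ.∨-cong (square-related h₁ (∨-regular u u) (∨-regular u′ u′))
                               (square-related h₂ (∨-regular w w) (∨-regular w′ w′))

  θxy-∧ : ∀ {u u′ w w′} → Θ u u′ → Θ w w′ → Θ (u ∧ w) (u′ ∧ w′)
  θxy-∧ {u} {u′} {w} {w′} h₁ h₂ = θ-rel (∧-regular u w) (∧-regular u′ w′)
    (subst₂ Related (∧-squares u w) (∧-squares u′ w′) squares-related _ _)
    where
    ∧-square-related : ∀ {s s′} → Θ s s′ → Related (s ∧ s) (s′ ∧ s′)
    ∧-square-related {s} {s′} h = subst₂ Related (∨∧-same s) (∨∧-same s′) (square-related h)
    squares-related : Related ((u ∧ u) ∧ (w ∧ w)) ((u′ ∧ u′) ∧ (w′ ∧ w′))
    squares-related = θ.∧-cong (∧-square-related h₁ (∧-regular u u) (∧-regular u′ u′))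
                               (∧-square-related h₂ (∧-regular w w) (∧-regular w′ w′))

  θxy-* : ∀ {u v} → Θ u v → Θ (u *) (v *)
  θxy-* (θ-rel ru rv h) = θ-rel (*-regular ru) (*-regular rv) (θ.*-cong h _ _)
  θxy-* Δ-rel = Δ-rel
  θxy-* (special x↦y) = special x*↦y*
  θxy-* (special y↦x) = special y*↦x*
  θxy-* (special x*↦y*) = special (inj₁ (compl-invol x , compl-invol y))
  θxy-* (special y*↦x*) = special (inj₂ (inj₁ (compl-invol y , compl-invol x)))

proposition5p9 : ∀ {a ℓ : Level} (Q : QBAlgebra a) →
    ¬ QBAlgebra.Flat Q →
    (θ : Rel (QBAlgebra.R Q) ℓ) → IsCongruenceR Q θ →
    (x y : QBAlgebra.Carrier Q) →
    ¬ QBAlgebra.Regular Q x →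
    QBAlgebra.cl Q (QBAlgebra._∨_ Q x x) y →
    ¬ QBAlgebra.Regular Q y →
    IsCongruence Q (θxy Q θ x y)
proposition5p9 Q nonflat θ C x y x-irregular y∈cl y-irregular = record
  { isEquivalence = record { refl = Δ-rel ; sym = θxy-sym ; trans = θxy-trans }
  ; ∨-cong = θxy-∨
  ; ∧-cong = θxy-∧
  ; *-cong = θxy-* }
  where open ThetaXY Q nonflat θ C x y x-irregular y∈cl y-irregular
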